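{- Let $G$ be a strongly regular graph and $\overline{G}$ its complement. Then $G$ is $2$-e.c. if and only if both $G$ and $\overline{G}$ are connected and both contain a triangle.
   Context: A graph $G$ with vertex set $V$ is $n$-e.c. if for every pair of disjoint subsets $A,B\subseteq V$ with $|A\cup B|=n$ (either may be empty) there is a vertex $z\notin A\cup B$ adjacent to every vertex of $A$ and to no vertex of $B$. A strongly regular graph with parameters $(v,k,\lambda,\mu)$ is a $k$-regular graph on $v$ vertices in which every pair of adjacent vertices has exactly $\lambda$ common neighbours and every pair of distinct nonadjacent vertices has exactly $\mu$ common neighbours; it is required to have at least one edge and at least one pair of distinct nonadjacent vertices. -}

module Defs where

open import Data.Bool using (Bool; true; false; T; _∧_; not)
open import Data.Nat using (ℕ; zero; suc; _+_)
open import Data.Fin using (Fin)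
open import Data.Fin.Subset using (Subset; _∈_; _∉_; _∩_; ∣_∣; Empty)
open import Data.Vec using (Vec; allFin; countᵇ)
open import Data.List using (List; []; _∷_)
open import Data.Product using (Σ; ∃; _×_; _,_)
open import Relation.Binary.PropositionalEquality using (_≡_)
open import Relation.Nullary using (¬_)

record Graph (v : ℕ) : Set where
  field
    adj   : Fin v → Fin v → Bool
    sym   : ∀ x y → adj x y ≡ adj y x
    irrefl : ∀ x → adj x x ≡ false
open Graph public

Adj : ∀ {v} → Graph v → Fin v → Fin v → Set
Adj G x y = T (adj G x y)

complement : ∀ {v} → Graph v → Graph v
complement {v} G = record
  { adj = λ x y → not (adj G x y) ∧ not (x ==ᶠ y)
  ; sym = λ x y → symC x y
  ; irrefl = λ x → irrC x }
  where
  open import Data.Fin using (_≟_)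
  open import Relation.Nullary using (does)
  open import Relation.Binary.PropositionalEquality using (refl; cong₂; cong)
  open import Data.Fin.Properties using (≡-isDecEquivalence)
  open import Data.Bool.Properties using (∧-zeroʳ)
  _==ᶠ_ : Fin v → Fin v → Bool
  x ==ᶠ y = does (x ≟ y)
  ==-sym : ∀ x y → (x ==ᶠ y) ≡ (y ==ᶠ x)
  ==-sym x y with x ≟ y | y ≟ x
  ... | Relation.Nullary.yes _ | Relation.Nullary.yes _ = refl
  ... | Relation.Nullary.no _  | Relation.Nullary.no _  = refl
  ... | Relation.Nullary.yes p | Relation.Nullary.no q  = Data.Empty.⊥-elim (q (Relation.Binary.PropositionalEquality.sym p))
    where import Data.Empty
  ... | Relation.Nullary.no q  | Relation.Nullary.yes p = Data.Empty.⊥-elim (q (Relation.Binary.PropositionalEquality.sym p))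
    where import Data.Empty
  symC : ∀ x y → (not (adj G x y) ∧ not (x ==ᶠ y)) ≡ (not (adj G y x) ∧ not (y ==ᶠ x))
  symC x y = cong₂ _∧_ (cong not (Graph.sym G x y)) (cong not (==-sym x y))
  irrC : ∀ x → (not (adj G x x) ∧ not (x ==ᶠ x)) ≡ false
  irrC x with x ≟ x
  ... | Relation.Nullary.yes _ = ∧-zeroʳ (not (adj G x x))
  ... | Relation.Nullary.no q = Data.Empty.⊥-elim (q refl)
    where import Data.Empty

commonNeighbours : ∀ {v} → Graph v → Fin v → Fin v → ℕ
commonNeighbours {v} G x y = countᵇ (λ z → adj G x z ∧ adj G y z) (allFin v)

degree : ∀ {v} → Graph v → Fin v → ℕ
degree {v} G x = countᵇ (λ z → adj G x z) (allFin v)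

record IsSRG {v : ℕ} (G : Graph v) (k lam mu : ℕ) : Set where
  field
    regular    : ∀ x → degree G x ≡ k
    adjCommon  : ∀ x y → Adj G x y → commonNeighbours G x y ≡ lam
    nonadjCommon : ∀ x y → ¬ x ≡ y → ¬ Adj G x y → commonNeighbours G x y ≡ mu
    hasEdge    : Σ (Fin v) λ x → Σ (Fin v) λ y → Adj G x y
    hasNonEdge : Σ (Fin v) λ x → Σ (Fin v) λ y → ¬ x ≡ y × ¬ Adj G x y

IsStronglyRegular : ∀ {v} → Graph v → Set
IsStronglyRegular {v} G = Σ ℕ λ k → Σ ℕ λ lam → Σ ℕ λ mu → IsSRG G k lam mu

IsNEC : ∀ {v} → ℕ → Graph v → Set
IsNEC {v} n G =
  (A B : Subset v) → Empty (A ∩ B) → ∣ A ∪ B ∣ ≡ n →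
  Σ (Fin v) λ z → z ∉ (A ∪ B) ×
    (∀ a → a ∈ A → Adj G z a) × (∀ b → b ∈ B → ¬ Adj G z b)
  where open import Data.Fin.Subset using (_∪_)

data Walk {v} (G : Graph v) : Fin v → Fin v → Set where
  here : ∀ {x} → Walk G x x
  step : ∀ {x y z} → Adj G x y → Walk G y z → Walk G x z

Connected : ∀ {v} → Graph v → Set
Connected {v} G = ∀ x y → Walk G x y

HasTriangle : ∀ {v} → Graph v → Set
HasTriangle {v} G = Σ (Fin v) λ x → Σ (Fin v) λ y → Σ (Fin v) λ z →
  Adj G x y × Adj G y z × Adj G x z

-- In a strongly regular graph the number of vertices z ∉ {x, y} with prescribed
-- adjacencies (α to x, β to y) depends only on α, β and on whether x ~ y: for two
-- adjacencies it is λ or μ, and the other three counts follow from k-regularity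
-- by inclusion–exclusion. Hence G is 2-e.c. once each of the four patterns is
-- realized by one adjacent and by one non-adjacent pair. A triangle and an
-- induced path a ~ b ~ c, in G and in its complement, supply all eight; the
-- induced paths exist because both graphs are connected and neither is complete.
-- Conversely, 2-e.c. gives any two vertices a common neighbour and a common
-- non-neighbour, whence connectivity of G and its complement, and triangles
-- through an edge and through a non-edge.
module Submission where

open import Data.Bool using (Bool; true; false; T; not; _∧_; if_then_else_)
open import Data.Bool.Properties using (∧-identityʳ; ∧-zeroʳ; ∧-comm; T-∧; T-≡; T-not-≡; not-injective; not-involutive)
open import Data.Empty using (⊥-elim)
open import Data.Fin using (Fin; zero; suc; punchIn)
open import Data.Fin.Properties using (_≟_; any?; punchInᵢ≢i)
open import Data.Fin.Subset using (Subset; ∣_∣; _∈_; _∉_; ⁅_⁆; _∪_; ⊥)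
open import Data.Fin.Subset.Properties
  using (x∈⁅x⁆; x∈⁅y⁆⇒x≡y; p⊆p∪q; q⊆p∪q; x∈p∪q⁻; x∈p∩q⁺; x∈p∩q⁻; ∉⊥; ∪-identityˡ; ∪-identityʳ)
open import Data.Nat using (ℕ; zero; suc; _+_; _<_; z<s)
open import Data.Nat.Properties using (+-identityʳ; +-cancelˡ-≡; +-0-commutativeMonoid; <-irrefl; suc-injective)
open import Data.Product using (∃; ∃₂; _×_; _,_; Σ-syntax; proj₁; proj₂)
open import Data.Product.Function.NonDependent.Propositional using (_×-⇔_)
open import Data.Sum using (_⊎_; inj₁; inj₂)
import Data.Sum
open import Data.Vec using (countᵇ; tabulate; lookup; _∷_; [])
open import Data.Vec.Properties using ([]=⇒lookup; lookup⇒[]=)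
open import Function using (_∘_; _⇔_; mk⇔; Equivalence; id)
open import Function.Construct.Composition using (_⇔-∘_)
open import Function.Construct.Identity using (⇔-id)
open import Relation.Binary.PropositionalEquality
open import Relation.Nullary using (¬_; Dec; yes; no; does)
open import Relation.Nullary.Decidable using (T?; dec-true; dec-false)

open import Defs hiding (sym)

open import Algebra.Properties.CommutativeMonoid.Sum +-0-commutativeMonoid
  using (sum; sum-remove; sum-cong-≗; sum-replicate-zero; ∑-distrib-+)

private
  variable
    n : ℕ
    A : Set
    x y z x′ y′ : Fin n
    α β b : Bool

open ≡-Reasoning

T⇒≡true : T b → b ≡ true
T⇒≡true = Equivalence.to T-≡

≡true⇒T : b ≡ true → T b
≡true⇒T = Equivalence.from T-≡

¬T⇒≡false : ¬ T b → b ≡ false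
¬T⇒≡false {false} _  = refl
¬T⇒≡false {true}  ¬t = ⊥-elim (¬t _)

indicator : Bool → ℕ
indicator false = 0
indicator true  = 1

indicator-T : T b → indicator b ≡ 1
indicator-T {true} _ = refl

count : (Fin n → Bool) → ℕ
count p = sum (indicator ∘ p)

countᵇ-tabulate : ∀ (p : A → Bool) (f : Fin n → A) → countᵇ p (tabulate f) ≡ count (p ∘ f)
countᵇ-tabulate {n = zero}  p f = refl
countᵇ-tabulate {n = suc n} p f with p (f zero)
... | true  = cong suc (countᵇ-tabulate p (f ∘ suc))
... | false = countᵇ-tabulate p (f ∘ suc)

indicator-split : ∀ a b → indicator a ≡ indicator (a ∧ b) + indicator (a ∧ not b)
indicator-split true  true  = refl
indicator-split true  false = refl
indicator-split false _     = refl

count-split : ∀ (p q : Fin n → Bool) →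
  count p ≡ count (λ z → p z ∧ q z) + count (λ z → p z ∧ not (q z))
count-split p q = trans (sum-cong-≗ (λ z → indicator-split (p z) (q z)))
                        (∑-distrib-+ (λ z → indicator (p z ∧ q z)) (λ z → indicator (p z ∧ not (q z))))

count-cong : ∀ {p q : Fin n → Bool} → (∀ z → p z ≡ q z) → count p ≡ count q
count-cong p≗q = sum-cong-≗ (cong indicator ∘ p≗q)

count-none : ∀ (p : Fin n → Bool) → (∀ z → ¬ T (p z)) → count p ≡ 0
count-none {n} p none = trans (sum-cong-≗ (cong indicator ∘ ¬T⇒≡false ∘ none)) (sum-replicate-zero n)

count-point : ∀ (p : Fin n → Bool) x → count (λ z → p z ∧ does (z ≟ x)) ≡ indicator (p x)
count-point {suc n} p x = begin
  count q                                    ≡⟨ sum-remove {i = x} (indicator ∘ q) ⟩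
  indicator (q x) + count (q ∘ punchIn x)    ≡⟨ cong₂ _+_ (cong (λ d → indicator (p x ∧ d)) (dec-true (x ≟ x) refl))
                                                           (count-none _ away) ⟩
  indicator (p x ∧ true) + 0                 ≡⟨ cong₂ _+_ (cong indicator (∧-identityʳ (p x))) refl ⟩
  indicator (p x) + 0                        ≡⟨ +-identityʳ _ ⟩
  indicator (p x)                            ∎
  where
  q = λ z → p z ∧ does (z ≟ x)
  away : ∀ j → ¬ T (q (punchIn x j))
  away j t rewrite dec-false (punchIn x j ≟ x) (punchInᵢ≢i x j) | ∧-zeroʳ (p (punchIn x j)) = t

infixl 6 _∖_
_∖_ : (Fin n → Bool) → Fin n → Fin n → Bool
(p ∖ x) z = p z ∧ not (does (z ≟ x))

T-not-does : ∀ {P : Set} (d : Dec P) → T (not (does d)) ⇔ (¬ P)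
T-not-does (yes p) = mk⇔ (λ ()) (λ ¬p → ¬p p)
T-not-does (no ¬p) = mk⇔ (λ _ → ¬p) _

T-∖ : ∀ (p : Fin n → Bool) {x z} → T ((p ∖ x) z) ⇔ (T (p z) × z ≢ x)
T-∖ p {x} {z} = (⇔-id _ ×-⇔ T-not-does (z ≟ x)) ⇔-∘ T-∧

T-∖∖ : ∀ (p : Fin n → Bool) {x y z} → T ((p ∖ x ∖ y) z) ⇔ ((T (p z) × z ≢ x) × z ≢ y)
T-∖∖ p {x} = (T-∖ p ×-⇔ ⇔-id _) ⇔-∘ T-∖ (p ∖ x)

count-remove : ∀ (p : Fin n → Bool) x → count p ≡ indicator (p x) + count (p ∖ x)
count-remove p x = trans (count-split p (λ z → does (z ≟ x))) (cong (_+ count (p ∖ x)) (count-point p x))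

count-remove-two : ∀ (p : Fin n → Bool) {x y} → y ≢ x →
  count p ≡ indicator (p x) + (indicator (p y) + count (p ∖ x ∖ y))
count-remove-two p {x} {y} y≢x = begin
  count p                                                       ≡⟨ count-remove p x ⟩
  indicator (p x) + count (p ∖ x)                               ≡⟨ cong (indicator (p x) +_) (count-remove (p ∖ x) y) ⟩
  indicator (p x) + (indicator ((p ∖ x) y) + count (p ∖ x ∖ y)) ≡⟨ cong (λ b → indicator (p x) + (indicator b + count (p ∖ x ∖ y))) p∖x≗p ⟩
  indicator (p x) + (indicator (p y) + count (p ∖ x ∖ y))       ∎
  where
  p∖x≗p : (p ∖ x) y ≡ p y
  p∖x≗p = trans (cong (λ d → p y ∧ not d) (dec-false (y ≟ x) y≢x)) (∧-identityʳ (p y))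

count>0⇒∃ : ∀ (p : Fin n → Bool) → 0 < count p → ∃ (T ∘ p)
count>0⇒∃ p count>0 with any? (T? ∘ p)
... | yes ∃p = ∃p
... | no ¬∃p = ⊥-elim (<-irrefl (sym (count-none p (λ z t → ¬∃p (z , t)))) count>0)

count≡suc⇒∃ : ∀ (p : Fin n → Bool) {m} → count p ≡ suc m → ∃ λ x → T (p x) × count (p ∖ x) ≡ m
count≡suc⇒∃ p {m} count≡1+m with count>0⇒∃ p (subst (0 <_) (sym count≡1+m) z<s)
... | x , px = x , px , suc-injective (begin
  suc (count (p ∖ x))              ≡⟨ cong (_+ count (p ∖ x)) (indicator-T px) ⟨
  indicator (p x) + count (p ∖ x)  ≡⟨ count-remove p x ⟨
  count p                          ≡⟨ count≡1+m ⟩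
  suc m                            ∎)

∃⇒count>0 : ∀ (p : Fin n → Bool) {x} → T (p x) → 0 < count p
∃⇒count>0 p {x} t rewrite count-remove p x with p x
... | true = z<s

∣p∣≡count : ∀ (S : Subset n) → ∣ S ∣ ≡ count (lookup S)
∣p∣≡count []          = refl
∣p∣≡count (true ∷ S)  = cong suc (∣p∣≡count S)
∣p∣≡count (false ∷ S) = ∣p∣≡count S

x∈p⇔T : ∀ {S : Subset n} {x} → x ∈ S ⇔ T (lookup S x)
x∈p⇔T {S = S} {x} = mk⇔ (≡true⇒T ∘ []=⇒lookup) (lookup⇒[]= x S ∘ T⇒≡true)

Doubleton : Subset n → Set
Doubleton S = ∃₂ λ x y → x ≢ y × x ∈ S × y ∈ S × (∀ z → z ∈ S → z ≡ x ⊎ z ≡ y)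

∣p∣≡2⇔doubleton : ∀ {S : Subset n} → ∣ S ∣ ≡ 2 ⇔ Doubleton S
∣p∣≡2⇔doubleton {S = S} = mk⇔ size⇒doubleton doubleton⇒size
  where
  p = lookup S
  doubleton⇒size : Doubleton S → ∣ S ∣ ≡ 2
  doubleton⇒size (x , y , x≢y , x∈S , y∈S , S⊆xy) = begin
    ∣ S ∣                                                    ≡⟨ ∣p∣≡count S ⟩
    count p                                                  ≡⟨ count-remove-two p (x≢y ∘ sym) ⟩
    indicator (p x) + (indicator (p y) + count (p ∖ x ∖ y))  ≡⟨ cong₂ _+_ (member x∈S) (cong₂ _+_ (member y∈S) (count-none _ outside)) ⟩
    2                                                        ∎
    where
    member : ∀ {u} → u ∈ S → indicator (p u) ≡ 1
    member = indicator-T ∘ Equivalence.to x∈p⇔T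
    outside : ∀ z → ¬ T ((p ∖ x ∖ y) z)
    outside z t with Equivalence.to (T-∖∖ p) t
    ... | (pz , z≢x) , z≢y with S⊆xy z (Equivalence.from x∈p⇔T pz)
    ... | inj₁ z≡x = z≢x z≡x
    ... | inj₂ z≡y = z≢y z≡y

  size⇒doubleton : ∣ S ∣ ≡ 2 → Doubleton S
  size⇒doubleton |S|≡2 with count≡suc⇒∃ p (trans (sym (∣p∣≡count S)) |S|≡2)
  ... | x , px , count∖x≡1 with count≡suc⇒∃ (p ∖ x) count∖x≡1
  ... | y , p∖x-y , count∖x∖y≡0 with Equivalence.to (T-∖ p) p∖x-y
  ... | py , y≢x = x , y , y≢x ∘ sym , Equivalence.from x∈p⇔T px , Equivalence.from x∈p⇔T py , S⊆xy
    where
    S⊆xy : ∀ z → z ∈ S → z ≡ x ⊎ z ≡ y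
    S⊆xy z z∈S with z ≟ x | z ≟ y
    ... | yes z≡x | _       = inj₁ z≡x
    ... | no _    | yes z≡y = inj₂ z≡y
    ... | no z≢x  | no z≢y  = ⊥-elim (<-irrefl (sym count∖x∖y≡0) (∃⇒count>0 (p ∖ x ∖ y) outside))
      where
      outside : T ((p ∖ x ∖ y) z)
      outside = Equivalence.from (T-∖∖ p) ((Equivalence.to x∈p⇔T z∈S , z≢x) , z≢y)

x∈⁅x⁆∪⁅y⁆ : ∀ (x y : Fin n) → x ∈ ⁅ x ⁆ ∪ ⁅ y ⁆
x∈⁅x⁆∪⁅y⁆ x y = p⊆p∪q ⁅ y ⁆ (x∈⁅x⁆ x)

y∈⁅x⁆∪⁅y⁆ : ∀ (x y : Fin n) → y ∈ ⁅ x ⁆ ∪ ⁅ y ⁆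
y∈⁅x⁆∪⁅y⁆ x y = q⊆p∪q ⁅ x ⁆ ⁅ y ⁆ (x∈⁅x⁆ y)

∣⁅x⁆∪⁅y⁆∣≡2 : ∀ {x y : Fin n} → x ≢ y → ∣ ⁅ x ⁆ ∪ ⁅ y ⁆ ∣ ≡ 2
∣⁅x⁆∪⁅y⁆∣≡2 {x = x} {y} x≢y = Equivalence.from ∣p∣≡2⇔doubleton
  (x , y , x≢y , x∈⁅x⁆∪⁅y⁆ x y , y∈⁅x⁆∪⁅y⁆ x y , ⊆xy)
  where
  ⊆xy : ∀ z → z ∈ ⁅ x ⁆ ∪ ⁅ y ⁆ → z ≡ x ⊎ z ≡ y
  ⊆xy z z∈ = Data.Sum.map (x∈⁅y⁆⇒x≡y x) (x∈⁅y⁆⇒x≡y y) (x∈p∪q⁻ ⁅ x ⁆ ⁅ y ⁆ z∈)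

Adj-sym : ∀ (G : Graph n) → Adj G x y → Adj G y x
Adj-sym {x = x} {y = y} G = subst T (Graph.sym G x y)

Adj⇒≢ : ∀ (G : Graph n) → Adj G x y → x ≢ y
Adj⇒≢ {x = x} G x~x refl = subst T (irrefl G x) x~x

adj-complement : ∀ (G : Graph n) → x ≢ y → adj (complement G) x y ≡ not (adj G x y)
adj-complement {x = x} {y = y} G x≢y = trans (cong (λ d → not (adj G x y) ∧ not d) (dec-false (x ≟ y) x≢y)) (∧-identityʳ _)

adj-complement⁺ : ∀ (G : Graph n) → x ≢ y → adj G x y ≡ not α → adj (complement G) x y ≡ α
adj-complement⁺ G x≢y x-y = trans (adj-complement G x≢y) (trans (cong not x-y) (not-involutive _))

adj-complement⁻ : ∀ (G : Graph n) → x ≢ y → adj (complement G) x y ≡ not α → adj G x y ≡ α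
adj-complement⁻ G x≢y x-y = not-injective (trans (sym (adj-complement G x≢y)) x-y)

Adj-complement : ∀ (G : Graph n) → x ≢ y → ¬ Adj G x y → Adj (complement G) x y
Adj-complement G x≢y x≁y = ≡true⇒T (adj-complement⁺ G x≢y (¬T⇒≡false x≁y))

¬Adj-complement : ∀ (G : Graph n) → Adj G x y → ¬ Adj (complement G) x y
¬Adj-complement G x~y = subst T (adj-complement⁺ G (Adj⇒≢ G x~y) (T⇒≡true x~y))

-- With α = (x ∈ A) and β = (y ∈ A) this is the 2-e.c. condition for A ∪ B = {x, y}.
Realizes : Graph n → Bool → Bool → Fin n → Fin n → Set
Realizes G α β x y = ∃ λ z → z ≢ x × z ≢ y × adj G x z ≡ α × adj G y z ≡ β

SomePairRealizes : Graph n → Bool → Bool → Bool → Set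
SomePairRealizes G α β b = ∃₂ λ x y → x ≢ y × adj G x y ≡ b × Realizes G α β x y

somePair-swap : ∀ (G : Graph n) → SomePairRealizes G α β b → SomePairRealizes G β α b
somePair-swap G (x , y , x≢y , x-y , z , z≢x , z≢y , x-z , y-z) =
  y , x , x≢y ∘ sym , trans (Graph.sym G y x) x-y , z , z≢y , z≢x , y-z , x-z

complement-realizes⁺ : ∀ (G : Graph n) → Realizes G (not α) (not β) x y → Realizes (complement G) α β x y
complement-realizes⁺ G (z , z≢x , z≢y , x-z , y-z) =
  z , z≢x , z≢y , adj-complement⁺ G (z≢x ∘ sym) x-z , adj-complement⁺ G (z≢y ∘ sym) y-z

complement-realizes⁻ : ∀ (G : Graph n) → Realizes (complement G) (not α) (not β) x y → Realizes G α β x y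
complement-realizes⁻ G (z , z≢x , z≢y , x-z , y-z) =
  z , z≢x , z≢y , adj-complement⁻ G (z≢x ∘ sym) x-z , adj-complement⁻ G (z≢y ∘ sym) y-z

somePair-complement : ∀ (G : Graph n) →
  SomePairRealizes (complement G) (not α) (not β) (not b) → SomePairRealizes G α β b
somePair-complement G (x , y , x≢y , x-y , r) = x , y , x≢y , adj-complement⁻ G x≢y x-y , complement-realizes⁻ G r

InducedPath : Graph n → Set
InducedPath {n} G = Σ[ a ∈ Fin n ] Σ[ b ∈ Fin n ] Σ[ c ∈ Fin n ] Adj G a b × Adj G b c × a ≢ c × ¬ Adj G a c

walk⇒inducedPath : ∀ (G : Graph n) → Walk G x y → x ≢ y → ¬ Adj G x y → InducedPath G
walk⇒inducedPath G here x≢x _ = ⊥-elim (x≢x refl)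
walk⇒inducedPath {x = x} {y = y} G (step {y = w} x~w w⇝y) x≢y x≁y with T? (adj G w y)
... | yes w~y = x , w , y , x~w , w~y , x≢y , x≁y
... | no w≁y  = walk⇒inducedPath G w⇝y (λ { refl → x≁y x~w }) w≁y

triangle⇒somePair : ∀ (G : Graph n) → HasTriangle G → SomePairRealizes G true true true
triangle⇒somePair G (x , y , z , x~y , y~z , x~z) =
  x , y , Adj⇒≢ G x~y , T⇒≡true x~y , z , Adj⇒≢ G x~z ∘ sym , Adj⇒≢ G y~z ∘ sym , T⇒≡true x~z , T⇒≡true y~z

inducedPath⇒somePair-adjacent : ∀ (G : Graph n) → InducedPath G → SomePairRealizes G true false true
inducedPath⇒somePair-adjacent G (a , b , c , a~b , b~c , a≢c , a≁c) =
  b , a , Adj⇒≢ G a~b ∘ sym , T⇒≡true (Adj-sym G a~b) , c , Adj⇒≢ G b~c ∘ sym , a≢c ∘ sym , T⇒≡true b~c , ¬T⇒≡false a≁c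

inducedPath⇒somePair-nonadjacent : ∀ (G : Graph n) → InducedPath G → SomePairRealizes G true true false
inducedPath⇒somePair-nonadjacent G (a , b , c , a~b , b~c , a≢c , a≁c) =
  a , c , a≢c , ¬T⇒≡false a≁c , b , Adj⇒≢ G a~b ∘ sym , Adj⇒≢ G b~c , T⇒≡true a~b , T⇒≡true (Adj-sym G b~c)

-- A non-adjacent pair of G is an adjacent pair of its complement, with the pattern negated.
somePair-all : ∀ (G : Graph n) → HasTriangle G → HasTriangle (complement G) →
  InducedPath G → InducedPath (complement G) → ∀ α β b → SomePairRealizes G α β b
somePair-all G △ △ᶜ P Pᶜ = realized
  where
  Gᶜ = complement G
  realized : ∀ α β b → SomePairRealizes G α β b
  realized true  true  true  = triangle⇒somePair G △
  realized true  false true  = inducedPath⇒somePair-adjacent G P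
  realized false true  true  = somePair-swap G (inducedPath⇒somePair-adjacent G P)
  realized false false true  = somePair-complement G (inducedPath⇒somePair-nonadjacent Gᶜ Pᶜ)
  realized true  true  false = inducedPath⇒somePair-nonadjacent G P
  realized true  false false = somePair-complement G (somePair-swap Gᶜ (inducedPath⇒somePair-adjacent Gᶜ Pᶜ))
  realized false true  false = somePair-complement G (inducedPath⇒somePair-adjacent Gᶜ Pᶜ)
  realized false false false = somePair-complement G (triangle⇒somePair Gᶜ △ᶜ)

lit : Bool → Bool → Bool
lit true  = id
lit false = not

T-lit : ∀ α {b} → T (lit α b) ⇔ b ≡ α
T-lit true  = T-≡
T-lit false = T-not-≡

fits : Graph n → Bool → Bool → Fin n → Fin n → Fin n → Bool
fits G α β x y z = lit α (adj G x z) ∧ lit β (adj G y z)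

T-fits : ∀ (G : Graph n) α β → T (fits G α β x y z) ⇔ (adj G x z ≡ α × adj G y z ≡ β)
T-fits G α β = (T-lit α ×-⇔ T-lit β) ⇔-∘ T-∧

realizes⇔count>0 : ∀ (G : Graph n) α β → Realizes G α β x y ⇔ 0 < count (fits G α β x y ∖ x ∖ y)
realizes⇔count>0 {x = x} {y = y} G α β = mk⇔
  (λ (z , z≢x , z≢y , x-z) →
     ∃⇒count>0 (p ∖ x ∖ y) (Equivalence.from (T-∖∖ p) ((Equivalence.from (T-fits G α β) x-z , z≢x) , z≢y)))
  (λ count>0 → let z , t = count>0⇒∃ (p ∖ x ∖ y) count>0
                   (fits-z , z≢x) , z≢y = Equivalence.to (T-∖∖ p) t
               in z , z≢x , z≢y , Equivalence.to (T-fits G α β) fits-z)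
  where p = fits G α β x y

SameType : Graph n → Fin n → Fin n → Fin n → Fin n → Set
SameType G x y x′ y′ = x ≢ y × x′ ≢ y′ × adj G x y ≡ adj G x′ y′

module StronglyRegular {G : Graph n} {k lam mu : ℕ} (srg : IsSRG G k lam mu) where
  open IsSRG srg

  Invariant : Bool → Bool → Set
  Invariant α β = ∀ {x y x′ y′} → SameType G x y x′ y′ → count (fits G α β x y) ≡ count (fits G α β x′ y′)

  count-neighbours : ∀ x → count (adj G x) ≡ k
  count-neighbours x = trans (sym (countᵇ-tabulate (adj G x) id)) (regular x)

  count-lit-neighbours : ∀ α x x′ → count (lit α ∘ adj G x) ≡ count (lit α ∘ adj G x′)
  count-lit-neighbours true  x x′ = trans (count-neighbours x) (sym (count-neighbours x′))
  count-lit-neighbours false x x′ = +-cancelˡ-≡ k _ _ (trans (sym (vertices x)) (vertices x′))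
    where
    vertices : ∀ u → count {n} (λ _ → true) ≡ k + count (not ∘ adj G u)
    vertices u = trans (count-split (λ _ → true) (adj G u)) (cong (_+ count (not ∘ adj G u)) (count-neighbours u))

  commonNeighbours≡ : x ≢ y → commonNeighbours G x y ≡ (if adj G x y then lam else mu)
  commonNeighbours≡ {x = x} {y = y} x≢y with adj G x y in x-y
  ... | true  = adjCommon x y (≡true⇒T x-y)
  ... | false = nonadjCommon x y x≢y (λ x~y → subst T x-y x~y)

  count-common-invariant : Invariant true true
  count-common-invariant {x} {y} {x′} {y′} (x≢y , x′≢y′ , x-y≡x′-y′) = begin
    count (fits G true true x y)       ≡⟨ countᵇ-tabulate (fits G true true x y) id ⟨
    commonNeighbours G x y             ≡⟨ commonNeighbours≡ x≢y ⟩
    (if adj G x y then lam else mu)    ≡⟨ cong (if_then lam else mu) x-y≡x′-y′ ⟩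
    (if adj G x′ y′ then lam else mu)  ≡⟨ commonNeighbours≡ x′≢y′ ⟨
    commonNeighbours G x′ y′           ≡⟨ countᵇ-tabulate (fits G true true x′ y′) id ⟩
    count (fits G true true x′ y′)     ∎

  flipʳ-invariant : ∀ α → Invariant α true → Invariant α false
  flipʳ-invariant α invariant {x} {y} {x′} {y′} same = +-cancelˡ-≡ (count (fits G α true x y)) _ _ (begin
    count (fits G α true x y) + count (fits G α false x y)    ≡⟨ count-split (lit α ∘ adj G x) (adj G y) ⟨
    count (lit α ∘ adj G x)                                   ≡⟨ count-lit-neighbours α x x′ ⟩
    count (lit α ∘ adj G x′)                                  ≡⟨ count-split (lit α ∘ adj G x′) (adj G y′) ⟩
    count (fits G α true x′ y′) + count (fits G α false x′ y′) ≡⟨ cong (_+ count (fits G α false x′ y′)) (invariant same) ⟨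
    count (fits G α true x y) + count (fits G α false x′ y′)  ∎)

  swap-invariant : Invariant true false → Invariant false true
  swap-invariant invariant {x} {y} {x′} {y′} (x≢y , x′≢y′ , x-y≡x′-y′) = begin
    count (fits G false true x y)    ≡⟨ count-cong (λ z → ∧-comm (not (adj G x z)) (adj G y z)) ⟩
    count (fits G true false y x)    ≡⟨ invariant (x≢y ∘ sym , x′≢y′ ∘ sym , y-x≡y′-x′) ⟩
    count (fits G true false y′ x′)  ≡⟨ count-cong (λ z → ∧-comm (adj G y′ z) (not (adj G x′ z))) ⟩
    count (fits G false true x′ y′)  ∎
    where
    y-x≡y′-x′ = trans (Graph.sym G y x) (trans x-y≡x′-y′ (Graph.sym G x′ y′))

  count-private-invariant : Invariant true false
  count-private-invariant = flipʳ-invariant true count-common-invariant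

  count-fits-invariant : ∀ α β → Invariant α β
  count-fits-invariant true  true  = count-common-invariant
  count-fits-invariant true  false = count-private-invariant
  count-fits-invariant false true  = swap-invariant count-private-invariant
  count-fits-invariant false false = flipʳ-invariant false (swap-invariant count-private-invariant)

  -- z = x and z = y contribute equally to pairs of the same type, as adj x x = false.
  count-outside-invariant : ∀ α β → SameType G x y x′ y′ →
    count (fits G α β x y ∖ x ∖ y) ≡ count (fits G α β x′ y′ ∖ x′ ∖ y′)
  count-outside-invariant {x = x} {y = y} {x′ = x′} {y′ = y′} α β same@(x≢y , x′≢y′ , x-y≡x′-y′) =
    +-cancelˡ-≡ (indicator (p y)) _ _ (+-cancelˡ-≡ (indicator (p x)) _ _ (begin
      indicator (p x) + (indicator (p y) + count (p ∖ x ∖ y))       ≡⟨ count-remove-two p (x≢y ∘ sym) ⟨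
      count p                                                       ≡⟨ count-fits-invariant α β same ⟩
      count p′                                                      ≡⟨ count-remove-two p′ (x′≢y′ ∘ sym) ⟩
      indicator (p′ x′) + (indicator (p′ y′) + count (p′ ∖ x′ ∖ y′)) ≡⟨ cong₂ (λ a b → indicator a + (indicator b + count (p′ ∖ x′ ∖ y′))) p-x≡p′-x′ p-y≡p′-y′ ⟨
      indicator (p x) + (indicator (p y) + count (p′ ∖ x′ ∖ y′))     ∎))
    where
    p = fits G α β x y
    p′ = fits G α β x′ y′
    p-x≡p′-x′ : p x ≡ p′ x′
    p-x≡p′-x′ = cong₂ (λ a b → lit α a ∧ lit β b) (trans (irrefl G x) (sym (irrefl G x′)))
                      (trans (Graph.sym G y x) (trans x-y≡x′-y′ (Graph.sym G x′ y′)))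
    p-y≡p′-y′ : p y ≡ p′ y′
    p-y≡p′-y′ = cong₂ (λ a b → lit α a ∧ lit β b) x-y≡x′-y′ (trans (irrefl G y) (sym (irrefl G y′)))

  realizes-transfer : ∀ α β → SameType G x y x′ y′ → Realizes G α β x′ y′ → Realizes G α β x y
  realizes-transfer α β same realizes′ = Equivalence.from (realizes⇔count>0 G α β)
    (subst (0 <_) (sym (count-outside-invariant α β same)) (Equivalence.to (realizes⇔count>0 G α β) realizes′))

  realizes-all : (∀ α β b → SomePairRealizes G α β b) → ∀ α β {x y} → x ≢ y → Realizes G α β x y
  realizes-all somePair α β {x} {y} x≢y with somePair α β (adj G x y)
  ... | x′ , y′ , x′≢y′ , x′-y′ , realizes′ = realizes-transfer α β (x≢y , x′≢y′ , sym x′-y′) realizes′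

nec2⇒adjacentToAll : ∀ (G : Graph n) → IsNEC 2 G → ∀ A → ∣ A ∣ ≡ 2 → ∃ λ z → z ∉ A × (∀ a → a ∈ A → Adj G z a)
nec2⇒adjacentToAll G nec A |A|≡2
  with nec A ⊥ (λ (_ , u∈A∩⊥) → ∉⊥ (proj₂ (x∈p∩q⁻ A ⊥ u∈A∩⊥))) (subst (λ S → ∣ S ∣ ≡ 2) (sym (∪-identityʳ A)) |A|≡2)
... | z , z∉ , z~A , _ = z , z∉ ∘ p⊆p∪q ⊥ , z~A

nec2⇒adjacentToNone : ∀ (G : Graph n) → IsNEC 2 G → ∀ B → ∣ B ∣ ≡ 2 → ∃ λ z → z ∉ B × (∀ b → b ∈ B → ¬ Adj G z b)
nec2⇒adjacentToNone G nec B |B|≡2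
  with nec ⊥ B (λ (_ , u∈⊥∩B) → ∉⊥ (proj₁ (x∈p∩q⁻ ⊥ B u∈⊥∩B))) (subst (λ S → ∣ S ∣ ≡ 2) (sym (∪-identityˡ B)) |B|≡2)
... | z , z∉ , _ , z≁B = z , z∉ ∘ q⊆p∪q ⊥ B , z≁B

nec2⇒commonNeighbour : ∀ (G : Graph n) → IsNEC 2 G → x ≢ y → Realizes G true true x y
nec2⇒commonNeighbour {x = x} {y = y} G nec x≢y with nec2⇒adjacentToAll G nec (⁅ x ⁆ ∪ ⁅ y ⁆) (∣⁅x⁆∪⁅y⁆∣≡2 x≢y)
... | z , z∉ , z~ = z , (λ { refl → z∉ (x∈⁅x⁆∪⁅y⁆ x y) }) , (λ { refl → z∉ (y∈⁅x⁆∪⁅y⁆ x y) }) ,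
                    T⇒≡true (Adj-sym G (z~ x (x∈⁅x⁆∪⁅y⁆ x y))) , T⇒≡true (Adj-sym G (z~ y (y∈⁅x⁆∪⁅y⁆ x y)))

nec2⇒commonNonNeighbour : ∀ (G : Graph n) → IsNEC 2 G → x ≢ y → Realizes G false false x y
nec2⇒commonNonNeighbour {x = x} {y = y} G nec x≢y with nec2⇒adjacentToNone G nec (⁅ x ⁆ ∪ ⁅ y ⁆) (∣⁅x⁆∪⁅y⁆∣≡2 x≢y)
... | z , z∉ , z≁ = z , (λ { refl → z∉ (x∈⁅x⁆∪⁅y⁆ x y) }) , (λ { refl → z∉ (y∈⁅x⁆∪⁅y⁆ x y) }) ,
                    ¬T⇒≡false (z≁ x (x∈⁅x⁆∪⁅y⁆ x y) ∘ Adj-sym G) , ¬T⇒≡false (z≁ y (y∈⁅x⁆∪⁅y⁆ x y) ∘ Adj-sym G)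

realizes-all⇒nec2 : ∀ (G : Graph n) → (∀ α β {x y} → x ≢ y → Realizes G α β x y) → IsNEC 2 G
realizes-all⇒nec2 G realizes A B A∩B≡∅ |A∪B|≡2 with Equivalence.to ∣p∣≡2⇔doubleton |A∪B|≡2
... | x , y , x≢y , _ , _ , A∪B⊆xy with realizes (lookup A x) (lookup A y) x≢y
... | z , z≢x , z≢y , x-z , y-z = z , z∉A∪B , z~A , z≁B
  where
  adj≡lookup : ∀ u → u ∈ A ∪ B → adj G u z ≡ lookup A u
  adj≡lookup u u∈ with A∪B⊆xy u u∈
  ... | inj₁ refl = x-z
  ... | inj₂ refl = y-z
  z∉A∪B : z ∉ A ∪ B
  z∉A∪B z∈ with A∪B⊆xy z z∈
  ... | inj₁ z≡x = z≢x z≡x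
  ... | inj₂ z≡y = z≢y z≡y
  z~A : ∀ a → a ∈ A → Adj G z a
  z~A a a∈A = Adj-sym G (≡true⇒T (trans (adj≡lookup a (p⊆p∪q B a∈A)) ([]=⇒lookup a∈A)))
  z≁B : ∀ b → b ∈ B → ¬ Adj G z b
  z≁B b b∈B z~b = A∩B≡∅ (b , x∈p∩q⁺ (lookup⇒[]= b A (trans (sym b-z) (T⇒≡true (Adj-sym G z~b))) , b∈B))
    where b-z = adj≡lookup b (q⊆p∪q A B b∈B)

commonNeighbours⇒connected : ∀ (G : Graph n) → (∀ {x y} → x ≢ y → Realizes G true true x y) → Connected G
commonNeighbours⇒connected G common x y with x ≟ y
... | yes refl = here
... | no x≢y with common x≢y
...   | z , _ , _ , x-z , y-z = step (≡true⇒T x-z) (step (Adj-sym G (≡true⇒T y-z)) here)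

commonNeighbour⇒triangle : ∀ (G : Graph n) → Adj G x y → Realizes G true true x y → HasTriangle G
commonNeighbour⇒triangle {x = x} {y = y} G x~y (z , _ , _ , x-z , y-z) = x , y , z , x~y , ≡true⇒T y-z , ≡true⇒T x-z

mainTheorem2 : ∀ {v : ℕ} (G : Graph v) → IsStronglyRegular G →
    IsNEC 2 G ⇔ (Connected G × Connected (complement G) × HasTriangle G × HasTriangle (complement G))
mainTheorem2 G (k , lam , mu , srg) with IsSRG.hasEdge srg | IsSRG.hasNonEdge srg
... | x , y , x~y | u , w , u≢w , u≁w = mk⇔ forward backward
  where
  forward : IsNEC 2 G → Connected G × Connected (complement G) × HasTriangle G × HasTriangle (complement G)
  forward nec =
      commonNeighbours⇒connected G common
    , commonNeighbours⇒connected (complement G) commonᶜ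
    , commonNeighbour⇒triangle G x~y (common (Adj⇒≢ G x~y))
    , commonNeighbour⇒triangle (complement G) (Adj-complement G u≢w u≁w) (commonᶜ u≢w)
    where
    common : ∀ {x y} → x ≢ y → Realizes G true true x y
    common = nec2⇒commonNeighbour G nec
    commonᶜ : ∀ {x y} → x ≢ y → Realizes (complement G) true true x y
    commonᶜ x≢y = complement-realizes⁺ G (nec2⇒commonNonNeighbour G nec x≢y)

  backward : Connected G × Connected (complement G) × HasTriangle G × HasTriangle (complement G) → IsNEC 2 G
  backward (connected , connectedᶜ , triangle , triangleᶜ) =
    realizes-all⇒nec2 G (StronglyRegular.realizes-all srg (somePair-all G triangle triangleᶜ path pathᶜ))
    where
    path  = walk⇒inducedPath G (connected u w) u≢w u≁w
    pathᶜ = walk⇒inducedPath (complement G) (connectedᶜ x y) (Adj⇒≢ G x~y) (¬Adj-complement G x~y)
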